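{- Let $\varepsilon\colon X^{\times}_{\mathrm{irr}}\to\mathcal{P}(M)$ be a Fitch map, let $k\in\mathbb{N}$, and let $\widehat{T}(\varepsilon)=(\widehat{T},\widehat{\lambda})$ be the $\varepsilon$-tree. The following are equivalent: (1) $\varepsilon$ is a $k$-restricted Fitch map; (2) $|\widehat{\lambda}(e)|\le k$ for every edge $e\in E(\widehat{T})$; (3) $\varepsilon$ satisfies the $k$-edge-label-condition.
   Context: $X$ is a finite nonempty set, $M$ a finite nonempty set of colors, $X^{\times}_{\mathrm{irr}}=\{(x,y)\in X\times X: x\neq y\}$. A phylogenetic tree on $X$ is a rooted tree whose leaves (non-root vertices of degree $1$) form $X$, whose root has degree $\ge2$ and whose non-root inner vertices have degree $\ge3$; it is determined up to isomorphism by its cluster set $\mathcal{C}(T)=\{C_T(v):v\in V(T)\}$ ($C_T(v)$ = leaves descending from $v$). $\mathrm{lca}(x,y)$ is the last common ancestor; edges are written $(\mathrm{par}(v),v)$. An edge-labeled tree $(T,\lambda)$ on $X$ with $M$ is a phylogenetic tree $T$ on $X$ with $\lambda\colon E(T)\to\mathcal{P}(M)$; $e$ is an $m$-edge if $m\in\lambda(e)$. $(T,\lambda)$ explains $\varepsilon$ if for all $(x,y)\in X^{\times}_{\mathrm{irr}}$, $m\in M$: $m\in\varepsilon(x,y)$ iff the path from $\mathrm{lca}(x,y)$ to $y$ contains an $m$-edge; $\varepsilon$ is a Fitch map if some edge-labeled tree explains it, and a $k$-restricted Fitch map if some edge-labeled tree $(T,\lambda)$ with $|\lambda(e)|\le k$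 for all $e\in E(T)$ explains it. $N_m[y]=\{x\in X\setminus\{y\}: m\notin\varepsilon(x,y)\}\cup\{y\}$, $\mathcal{N}[\varepsilon]=\{N_m[y]: y\in X, m\in M\}$. $\varepsilon$ satisfies the $k$-edge-label-condition if for every $N\in\mathcal{N}[\varepsilon]$ with $N\neq X$, $|\{m\in M: \exists y\in X,\ N=N_m[y]\}|\le k$. The $\varepsilon$-tree: $\mathcal{C}(\widehat{T})=\mathcal{N}[\varepsilon]\cup\{X\}\cup\{\{x\}:x\in X\}$ and $\widehat{\lambda}(\mathrm{par}(v),v)=\{m\in M:\exists y\in X,\ C_{\widehat{T}}(v)=N_m[y]\}$. -}

module Defs where

open import Data.Nat using (ℕ; _≤_)
open import Data.Bool using (Bool; true; false; not; if_then_else_)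
import Data.Bool.Properties as BoolP
open import Data.Fin using (Fin)
open import Data.Fin.Properties using (any?) renaming (_≟_ to _≟F_)
open import Data.Fin.Subset using (Subset; ⊤; ⁅_⁆; _∈_; _∉_; _⊆_; _∩_; ∣_∣; Nonempty; Empty)
open import Data.Fin.Subset.Properties using (_∈?_)
open import Data.Vec using (tabulate)
open import Data.Vec.Properties using (≡-dec)
open import Data.List using (List)
import Data.List.Membership.Propositional as LM
open import Data.Product using (Σ; ∃; ∃-syntax; _×_; _,_)
open import Data.Sum using (_⊎_)
open import Relation.Nullary using (¬_; Dec; does)
open import Relation.Binary.PropositionalEquality using (_≡_; _≢_)
open import Function.Bundles using (_⇔_)

-- Leaf set X = Fin n, colour set M = Fin c.
-- A map ε : X^×_irr → P(M) is represented as a function on all pairs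
-- ε x y : Subset c ; its values on the diagonal (x ≡ y) are never used.

EMap : ℕ → ℕ → Set
EMap n c = Fin n → Fin n → Subset c

_≟S_ : ∀ {n} → (A B : Subset n) → Dec (A ≡ B)
_≟S_ = ≡-dec BoolP._≟_

-- Phylogenetic trees on X, represented (as in the paper) by their
-- cluster set C(T): a list of clusters.  Such a list is the cluster set
-- of a phylogenetic tree iff it is a hierarchy containing X and all
-- singletons (vertices of T ↔ clusters, root ↔ X, leaves ↔ singletons,
-- edge (par(v),v) ↔ non-root cluster C_T(v)).

record PhyloTree (n : ℕ) : Set where
  field
    clusters  : List (Subset n)
    hasRoot   : ⊤ LM.∈ clusters
    hasLeaves : ∀ x → ⁅ x ⁆ LM.∈ clusters
    nonempty  : ∀ {C} → C LM.∈ clusters → Nonempty C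
    laminar   : ∀ {A B} → A LM.∈ clusters → B LM.∈ clusters →
                A ⊆ B ⊎ B ⊆ A ⊎ Empty (A ∩ B)
open PhyloTree public

IsEdge : ∀ {n} → PhyloTree n → Subset n → Set
IsEdge T C = C LM.∈ clusters T × C ≢ ⊤

-- An edge-labeled tree: a phylogenetic tree with λ : E(T) → P(M)
-- (λ is given on all clusters; only its values on edges matter).
record EdgeLabeledTree (n c : ℕ) : Set where
  field
    tree  : PhyloTree n
    label : Subset n → Subset c
open EdgeLabeledTree public

-- The path from lca(x,y) to y contains the edge (par(v),v) iff
-- v lies strictly below lca(x,y) and above (or equal to) y, i.e. iff
-- y ∈ C_T(v) and x ∉ C_T(v).
PathHasColour : ∀ {n c} → EdgeLabeledTree n c → Fin n → Fin n → Fin c → Set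
PathHasColour Tλ x y m =
  ∃[ C ] (IsEdge (tree Tλ) C × y ∈ C × x ∉ C × m ∈ label Tλ C)

Explains : ∀ {n c} → EdgeLabeledTree n c → EMap n c → Set
Explains Tλ ε = ∀ x y → x ≢ y → ∀ m → (m ∈ ε x y ⇔ PathHasColour Tλ x y m)

IsFitchMap : ∀ {n c} → EMap n c → Set
IsFitchMap {n} {c} ε = Σ (EdgeLabeledTree n c) λ Tλ → Explains Tλ ε

IsKRestrictedFitchMap : ∀ {n c} → ℕ → EMap n c → Set
IsKRestrictedFitchMap {n} {c} k ε =
  Σ (EdgeLabeledTree n c) λ Tλ →
    (∀ e → IsEdge (tree Tλ) e → ∣ label Tλ e ∣ ≤ k) × Explains Tλ ε

Nbh : ∀ {n c} → EMap n c → Fin c → Fin n → Subset n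
Nbh ε m y = tabulate λ x →
  if does (x ≟F y) then true else not (does (m ∈? ε x y))

InN : ∀ {n c} → EMap n c → Subset n → Set
InN ε N = ∃[ y ] ∃[ m ] N ≡ Nbh ε m y

colsOf : ∀ {n c} → EMap n c → Subset n → Subset c
colsOf ε N = tabulate λ m → does (any? λ y → N ≟S Nbh ε m y)

KEdgeLabelCondition : ∀ {n c} → ℕ → EMap n c → Set
KEdgeLabelCondition k ε = ∀ N → InN ε N → N ≢ ⊤ → ∣ colsOf ε N ∣ ≤ k

-- The ε-tree: C(T̂) = 𝒩[ε] ∪ {X} ∪ {{x} : x ∈ X},
-- λ̂(par(v),v) = {m : ∃ y, C_T̂(v) = N_m[y]}.

InEpsTreeClusters : ∀ {n c} → EMap n c → Subset n → Set
InEpsTreeClusters ε C = InN ε C ⊎ C ≡ ⊤ ⊎ ∃[ x ] C ≡ ⁅ x ⁆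

epsTreeLabel : ∀ {n c} → EMap n c → Subset n → Subset c
epsTreeLabel = colsOf

IsEpsTreeEdge : ∀ {n c} → EMap n c → Subset n → Set
IsEpsTreeEdge ε C = InEpsTreeClusters ε C × C ≢ ⊤

{-# OPTIONS --safe #-}
module Submission where

-- Let (T, λ) explain ε and N_m[y] ≠ X. The m-edges above y form a chain in T; every x
-- outside the lowest one, D, sees an m-edge on its path to y, while an x inside D would
-- need an m-edge above y that misses x, i.e. one strictly below D. So N_m[y] = D is an
-- edge of T carrying m, and every colour λ̂ assigns to N is already in λ(N), whence
-- |λ̂(N)| ≤ |λ(N)|. Conversely, relabelling any explaining tree by λ̂ still explains ε,
-- and under the k-edge-label condition all its labels have size at most k.

open import Defs
open import Data.Nat using (ℕ; suc; _≤_; z≤n)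
open import Data.Nat.Properties using (≤-trans; ≤⇒≯)
open import Data.Bool using (Bool; true; not; if_then_else_)
open import Data.Fin using (Fin)
open import Data.Fin.Properties using (any?; ¬∀⟶∃¬) renaming (_≟_ to _≟F_)
open import Data.Fin.Subset using (Subset; ⊤; _∈_; _∉_; _⊆_; ∣_∣)
open import Data.Fin.Subset.Properties
  using (_∈?_; ⊆-antisym; ⊆⊤; ∈⊤; p⊆q⇒∣p∣≤∣q∣; p⊂q⇒∣p∣<∣q∣; x∈p∩q⁺; nonempty?; Empty-unique; ∣⊥∣≡0)
open import Data.Vec using (tabulate)
open import Data.Vec.Properties using (lookup∘tabulate; []=⇒lookup; lookup⇒[]=)
open import Data.List using (filter)
import Data.List.Membership.Propositional as List
open import Data.List.Membership.Propositional.Properties using (∈-filter⁺; ∈-filter⁻)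
import Data.List.Relation.Unary.All as All
open import Data.List.Extrema.Nat using (argmin; argmin-all; f[argmin]≤f[xs])
open import Data.Product using (∃; ∃-syntax; _×_; _,_; proj₁; proj₂)
open import Data.Sum using (_⊎_; inj₁; inj₂; [_,_]′)
open import Function using (_∘_; const; flip)
open import Function.Bundles using (_⇔_; mk⇔; Equivalence)
import Function.Properties.Equivalence as ⇔
open import Relation.Nullary using (Dec; yes; no; does; contradiction)
open import Relation.Nullary.Decidable using (_×-dec_; ¬?; decidable-stable)
open import Relation.Unary using (Decidable)
open import Relation.Binary.PropositionalEquality using (_≡_; _≢_; refl; sym; trans; subst)

open Equivalence using (to; from)

∈-tabulate⇔ : ∀ {n} {f : Fin n → Bool} {x} → x ∈ tabulate f ⇔ f x ≡ true
∈-tabulate⇔ {f = f} {x} = mk⇔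
  (λ x∈ → trans (sym (lookup∘tabulate f x)) ([]=⇒lookup x∈))
  (λ fx → lookup⇒[]= x _ (trans (lookup∘tabulate f x) fx))

does≡true⇔ : ∀ {A : Set} (a? : Dec A) → does a? ≡ true ⇔ A
does≡true⇔ (yes a) = mk⇔ (const a) (const refl)
does≡true⇔ (no ¬a) = mk⇔ (λ ()) (λ a → contradiction a ¬a)

≢⊤⇒∃∉ : ∀ {n} {p : Subset n} → p ≢ ⊤ → ∃ (_∉ p)
≢⊤⇒∃∉ {n} {p} p≢⊤ = ¬∀⟶∃¬ n (_∈ p) (_∈? p) (λ ∀∈ → p≢⊤ (⊆-antisym ⊆⊤ (λ {x} _ → ∀∈ x)))

p⊆q∧∣q∣≤∣p∣⇒q⊆p : ∀ {n} {p q : Subset n} → p ⊆ q → ∣ q ∣ ≤ ∣ p ∣ → q ⊆ p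
p⊆q∧∣q∣≤∣p∣⇒q⊆p {p = p} p⊆q ∣q∣≤∣p∣ {x} x∈q with x ∈? p
... | yes x∈p = x∈p
... | no  x∉p = contradiction (p⊂q⇒∣p∣<∣q∣ (p⊆q , x , x∈q , x∉p)) (≤⇒≯ ∣q∣≤∣p∣)

module _ {n : ℕ} (T : PhyloTree n) where

  overlapping-clusters-comparable : ∀ {A B x} → A List.∈ clusters T → B List.∈ clusters T →
                                    x ∈ A → x ∈ B → A ⊆ B ⊎ B ⊆ A
  overlapping-clusters-comparable A∈ B∈ x∈A x∈B with laminar T A∈ B∈
  ... | inj₁ A⊆B               = inj₁ A⊆B
  ... | inj₂ (inj₁ B⊆A)        = inj₂ B⊆A
  ... | inj₂ (inj₂ A∩B-empty) = contradiction (_ , x∈p∩q⁺ (x∈A , x∈B)) A∩B-empty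

  -- The clusters satisfying P all contain x, so they form a chain, and the smallest one is least.
  least-cluster : ∀ {P : Subset n → Set} → Decidable P → ∀ {x} → (∀ {D} → P D → x ∈ D) →
                  ∀ {D₀} → D₀ List.∈ clusters T → P D₀ →
                  ∃[ D ] (D List.∈ clusters T × P D × (∀ {D′} → D′ List.∈ clusters T → P D′ → D ⊆ D′))
  least-cluster {P} P? P⇒∋x {D₀} D₀∈ PD₀ = D , D∈ , PD , least
    where
    candidates = filter P? (clusters T)
    D = argmin ∣_∣ D₀ candidates

    D∈×PD : D List.∈ clusters T × P D
    D∈×PD = argmin-all ∣_∣ (D₀∈ , PD₀) (All.tabulate (∈-filter⁻ P?))
    D∈ = proj₁ D∈×PD
    PD = proj₂ D∈×PD

    least : ∀ {D′} → D′ List.∈ clusters T → P D′ → D ⊆ D′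
    least D′∈ PD′ with overlapping-clusters-comparable D∈ D′∈ (P⇒∋x PD) (P⇒∋x PD′)
    ... | inj₁ D⊆D′ = D⊆D′
    ... | inj₂ D′⊆D = p⊆q∧∣q∣≤∣p∣⇒q⊆p D′⊆D
                        (All.lookup (f[argmin]≤f[xs] D₀ candidates) (∈-filter⁺ P? D′∈ PD′))

module _ {n c : ℕ} (ε : EMap n c) (m : Fin c) (y : Fin n) where

  ∈Nbh⇔ : ∀ {x} → x ∈ Nbh ε m y ⇔ (x ≡ y ⊎ m ∉ ε x y)
  ∈Nbh⇔ {x} = ⇔.trans ∈-tabulate⇔ isNbh⇔
    where
    isNbh⇔ : (if does (x ≟F y) then true else not (does (m ∈? ε x y))) ≡ true ⇔ (x ≡ y ⊎ m ∉ ε x y)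
    isNbh⇔ with x ≟F y | m ∈? ε x y
    ... | yes x≡y | _      = mk⇔ (const (inj₁ x≡y)) (const refl)
    ... | no _    | no m∉  = mk⇔ (const (inj₂ m∉)) (const refl)
    ... | no x≢y  | yes m∈ = mk⇔ (λ ()) [ flip contradiction x≢y , contradiction m∈ ]′

  y∈Nbh : y ∈ Nbh ε m y
  y∈Nbh = from ∈Nbh⇔ (inj₁ refl)

  ∉Nbh⇔ : ∀ {x} → x ∉ Nbh ε m y ⇔ (x ≢ y × m ∈ ε x y)
  ∉Nbh⇔ {x} = mk⇔
    (λ x∉ → x∉ ∘ from ∈Nbh⇔ ∘ inj₁ , decidable-stable (m ∈? ε x y) (x∉ ∘ from ∈Nbh⇔ ∘ inj₂))
    (λ (x≢y , m∈) x∈ → [ x≢y , contradiction m∈ ]′ (to ∈Nbh⇔ x∈))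

module _ {n c : ℕ} (ε : EMap n c) where

  ∈colsOf⇔ : ∀ {N m} → m ∈ colsOf ε N ⇔ (∃[ y ] N ≡ Nbh ε m y)
  ∈colsOf⇔ = ⇔.trans ∈-tabulate⇔ (does≡true⇔ (any? _))

  relabel : EdgeLabeledTree n c → EdgeLabeledTree n c
  relabel Tλ = record { tree = tree Tλ ; label = colsOf ε }

-- D is the cluster below an m-edge on the path from the root to y.
ColouredAbove : ∀ {n c} → EdgeLabeledTree n c → Fin c → Fin n → Subset n → Set
ColouredAbove Tλ m y D = D ≢ ⊤ × y ∈ D × m ∈ label Tλ D

ColouredAbove? : ∀ {n c} (Tλ : EdgeLabeledTree n c) m y → Decidable (ColouredAbove Tλ m y)
ColouredAbove? Tλ m y D = ¬? (D ≟S ⊤) ×-dec y ∈? D ×-dec m ∈? label Tλ D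

module Explanation {n c : ℕ} {ε : EMap n c} (Tλ : EdgeLabeledTree n c) (explains : Explains Tλ ε) where

  Nbh⊆ColouredAbove : ∀ {m y D} → D List.∈ clusters (tree Tλ) → ColouredAbove Tλ m y D → Nbh ε m y ⊆ D
  Nbh⊆ColouredAbove {m} {y} {D} D∈ (D≢⊤ , y∈D , m∈D) {x} x∈N with x ∈? D
  ... | yes x∈D = x∈D
  ... | no  x∉D = contradiction x∈N (from (∉Nbh⇔ ε m y) (x≢y , from (explains x y x≢y m) path))
    where
    x≢y : x ≢ y
    x≢y refl = x∉D y∈D
    path : PathHasColour Tλ x y m
    path = D , (D∈ , D≢⊤) , y∈D , x∉D , m∈D

  least-ColouredAbove⊆Nbh : ∀ {m y D} →
                      (∀ {D′} → D′ List.∈ clusters (tree Tλ) → ColouredAbove Tλ m y D′ → D ⊆ D′) →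
                      D ⊆ Nbh ε m y
  least-ColouredAbove⊆Nbh {m} {y} least {x} x∈D with x ∈? Nbh ε m y
  ... | yes x∈N = x∈N
  ... | no  x∉N =
    let (x≢y , m∈) = to (∉Nbh⇔ ε m y) x∉N
        (D′ , (D′∈ , D′≢⊤) , y∈D′ , x∉D′ , m∈D′) = to (explains x y x≢y m) m∈
    in contradiction (least D′∈ (D′≢⊤ , y∈D′ , m∈D′) x∈D) x∉D′

  Nbh-is-coloured-edge : ∀ m y → Nbh ε m y ≢ ⊤ →
                      Nbh ε m y List.∈ clusters (tree Tλ) × m ∈ label Tλ (Nbh ε m y)
  Nbh-is-coloured-edge m y N≢⊤ =
    let (x , x∉N) = ≢⊤⇒∃∉ N≢⊤
        (x≢y , m∈) = to (∉Nbh⇔ ε m y) x∉N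
        (D₀ , (D₀∈ , D₀≢⊤) , y∈D₀ , _ , m∈D₀) = to (explains x y x≢y m) m∈
        (D , D∈ , D-coloured , D-least) =
          least-cluster (tree Tλ) (ColouredAbove? Tλ m y) (proj₁ ∘ proj₂) D₀∈ (D₀≢⊤ , y∈D₀ , m∈D₀)
        N≡D = ⊆-antisym (Nbh⊆ColouredAbove D∈ D-coloured) (least-ColouredAbove⊆Nbh D-least)
    in subst (λ N → N List.∈ clusters (tree Tλ) × m ∈ label Tλ N) (sym N≡D) (D∈ , proj₂ (proj₂ D-coloured))

  ∈colsOf⇒coloured-edge : ∀ {N m} → N ≢ ⊤ → m ∈ colsOf ε N →
                          N List.∈ clusters (tree Tλ) × m ∈ label Tλ N
  ∈colsOf⇒coloured-edge N≢⊤ m∈ with to (∈colsOf⇔ ε) m∈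
  ... | y , refl = Nbh-is-coloured-edge _ y N≢⊤

  relabel-explains : Explains (relabel ε Tλ) ε
  relabel-explains x y x≢y m = mk⇔ path⁺ path⁻
    where
    path⁺ : m ∈ ε x y → PathHasColour (relabel ε Tλ) x y m
    path⁺ m∈ = Nbh ε m y , (proj₁ (Nbh-is-coloured-edge m y N≢⊤) , N≢⊤) , y∈Nbh ε m y , x∉N
                         , from (∈colsOf⇔ ε) (y , refl)
      where
      x∉N = from (∉Nbh⇔ ε m y) (x≢y , m∈)
      N≢⊤ : Nbh ε m y ≢ ⊤
      N≢⊤ N≡⊤ = x∉N (subst (x ∈_) (sym N≡⊤) ∈⊤)
    path⁻ : PathHasColour (relabel ε Tλ) x y m → m ∈ ε x y
    path⁻ (C , (C∈ , C≢⊤) , y∈C , x∉C , m∈) =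
      from (explains x y x≢y m) (C , (C∈ , C≢⊤) , y∈C , x∉C , proj₂ (∈colsOf⇒coloured-edge C≢⊤ m∈))

module _ {n c : ℕ} (ε : EMap n c) (k : ℕ) where

  restricted⇒edge-label-condition : IsKRestrictedFitchMap k ε → KEdgeLabelCondition k ε
  restricted⇒edge-label-condition (Tλ , bounded , explains) N (y , m , refl) N≢⊤ =
    ≤-trans (p⊆q⇒∣p∣≤∣q∣ (proj₂ ∘ ∈colsOf⇒coloured-edge N≢⊤))
            (bounded N (proj₁ (Nbh-is-coloured-edge m y N≢⊤) , N≢⊤))
    where open Explanation Tλ explains

  -- A non-root cluster outside 𝒩[ε] receives no colour from λ̂.
  edge-label-condition⇒∣colsOf∣≤ : KEdgeLabelCondition k ε → ∀ {N} → N ≢ ⊤ → ∣ colsOf ε N ∣ ≤ k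
  edge-label-condition⇒∣colsOf∣≤ condition {N} N≢⊤ with nonempty? (colsOf ε N)
  ... | yes (m , m∈) = let (y , N≡Nbh) = to (∈colsOf⇔ ε) m∈ in condition N (y , m , N≡Nbh) N≢⊤
  ... | no  empty rewrite Empty-unique empty | ∣⊥∣≡0 c = z≤n

  edge-label-condition⇒restricted : IsFitchMap ε → KEdgeLabelCondition k ε → IsKRestrictedFitchMap k ε
  edge-label-condition⇒restricted (Tλ , explains) condition =
    relabel ε Tλ , (λ _ (_ , e≢⊤) → edge-label-condition⇒∣colsOf∣≤ condition e≢⊤) , relabel-explains
    where open Explanation Tλ explains

  restricted⇔edge-label-condition : IsFitchMap ε → IsKRestrictedFitchMap k ε ⇔ KEdgeLabelCondition k ε
  restricted⇔edge-label-condition fitch =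
    mk⇔ restricted⇒edge-label-condition (edge-label-condition⇒restricted fitch)

  εTree-bounded⇔edge-label-condition :
    (∀ e → IsEpsTreeEdge ε e → ∣ epsTreeLabel ε e ∣ ≤ k) ⇔ KEdgeLabelCondition k ε
  εTree-bounded⇔edge-label-condition = mk⇔
    (λ bounded N N∈𝒩 N≢⊤ → bounded N (inj₁ N∈𝒩 , N≢⊤))
    (λ condition _ (_ , e≢⊤) → edge-label-condition⇒∣colsOf∣≤ condition e≢⊤)

proposition5 : ∀ {n c} (ε : EMap (suc n) (suc c)) → IsFitchMap ε → (k : ℕ) →
               (IsKRestrictedFitchMap k ε ⇔ (∀ e → IsEpsTreeEdge ε e → ∣ epsTreeLabel ε e ∣ ≤ k))
               × ((∀ e → IsEpsTreeEdge ε e → ∣ epsTreeLabel ε e ∣ ≤ k) ⇔ KEdgeLabelCondition k ε)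
proposition5 ε fitch k =
  ⇔.trans (restricted⇔edge-label-condition ε k fitch) (⇔.sym (εTree-bounded⇔edge-label-condition ε k)) ,
  εTree-bounded⇔edge-label-condition ε k
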